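{- Let $A$ be a finite alphabet, $c\ge0$ an integer and $X\subseteq A^{\mathbb{Z}}$ a subshift. Then $X$ is $c$-block gluing if and only if for every integer $n\geq1$, every pair $(u,v)$ of vertices of the Rauzy graph $G_n(X)$ and every integer $k\geq c+n-1$, there is a path of length $k$ from $u$ to $v$ in $G_n(X)$.
   Context: A subshift is a closed shift-invariant subset of $A^{\mathbb{Z}}$; $L_X$ is its language (finite words occurring in elements of $X$) and $L_X(m)$ the words of length $m$ in it ($L_X(0)$ consists of the empty word). $X$ is $c$-block gluing if for all $u,v\in L_X$ and every integer $m\geq c$ there is a word $w$ with $|w|=m$ and $uwv\in L_X$. The Rauzy graph $G_n(X)$ is the directed graph with vertex set $L_X(n-1)$, with an edge from $u=u_1\dots u_{n-1}$ to $v=v_1\dots v_{n-1}$ iff $u_2\dots u_{n-1}=v_1\dots v_{n-2}$ and $u_1\dots u_{n-1}v_{n-1}\in L_X(n)$; this edge is labelled by $v_{n-1}$. The length of a path is its number of edges. -}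

module Defs where

open import Data.Nat using (ℕ; zero; suc; _≤_; _∸_)
open import Data.Integer using (ℤ; +_; ∣_∣) renaming (_+_ to _+ℤ_; _-_ to _-ℤ_)
open import Data.Fin using (Fin)
open import Data.List using (List; []; _∷_; _++_; length; take; drop)
open import Data.Product using (Σ; ∃; _×_; _,_)
open import Data.Unit using (⊤)
open import Relation.Binary.PropositionalEquality using (_≡_)

Config : ℕ → Set
Config a = ℤ → Fin a

shift : ∀ {a} → Config a → Config a
shift x i = x (i +ℤ + 1)

ShiftInvariant : ∀ {a} → (Config a → Set) → Set
ShiftInvariant {a} X = (x : Config a) → (X x → X (shift x)) × (X (shift x) → X x)

-- Closed in the product topology: if every central window x_[-N,N] of x
-- is matched by some element of X, then x ∈ X.
Closed : ∀ {a} → (Config a → Set) → Set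
Closed {a} X = (x : Config a) →
  ((N : ℕ) → Σ (Config a) λ y → X y × ((i : ℤ) → ∣ i ∣ ≤ N → y i ≡ x i)) → X x

IsSubshift : ∀ {a} → (Config a → Set) → Set
IsSubshift X = ShiftInvariant X × Closed X

Word : ℕ → Set
Word a = List (Fin a)

OccursAt : ∀ {a} → Config a → ℤ → Word a → Set
OccursAt x i [] = ⊤
OccursAt x i (b ∷ w) = (x i ≡ b) × OccursAt x (i +ℤ + 1) w

Lang : ∀ {a} → (Config a → Set) → Word a → Set
Lang {a} X w = Σ (Config a) λ x → X x × Σ ℤ λ i → OccursAt x i w

BlockGluing : ∀ {a} → (Config a → Set) → ℕ → Set
BlockGluing {a} X c = (u v : Word a) → Lang X u → Lang X v →
  (m : ℕ) → c ≤ m → Σ (Word a) λ w → (length w ≡ m) × Lang X (u ++ w ++ v)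

RauzyVertex : ∀ {a} → (Config a → Set) → ℕ → Word a → Set
RauzyVertex X n u = Lang X u × (length u ≡ n ∸ 1)

-- Edges of G_n(X): u → v iff there is w ∈ L_X(n) with u = w_1…w_{n-1}
-- and v = w_2…w_n (i.e. w = u v_{n-1}); for n = 1 these are the loops
-- at the empty word labelled by the letters of L_X(1).
RauzyEdge : ∀ {a} → (Config a → Set) → ℕ → Word a → Word a → Set
RauzyEdge {a} X n u v = Σ (Word a) λ w →
  Lang X w × (length w ≡ n) × (take (n ∸ 1) w ≡ u) × (drop 1 w ≡ v)

data RauzyPath {a} (X : Config a → Set) (n : ℕ) : Word a → Word a → ℕ → Set where
  nil  : ∀ {u} → RauzyPath X n u u 0
  cons : ∀ {u w v k} → RauzyEdge X n u w → RauzyPath X n w v k →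
         RauzyPath X n u v (suc k)

-- An edge of G_{n+1}(X) is a word of L_X(n+1), so a path of length k in G_{n+1}(X) spells a
-- word of length n + k that starts with its first vertex, ends with its last one, and whose
-- length-n factors at positions 0, …, k are the vertices it visits; conversely every word of
-- L_X of length n + k gives such a path. If X is c-block gluing, gluing two vertices u, v with
-- a word of length k − n therefore yields a path of length k from u to v. Conversely, to glue
-- u and v with a gap m ≥ c, extend u to the left and v to the right to vertices of the same
-- length N = |u| + m + |v| and take a path of length N + m between them: the vertex it visits
-- after N − |u| steps is u w v with |w| = m, and it lies in L_X.
module Submission where

open import Defs
open import Data.Nat using (ℕ; zero; suc; _≤_; _+_; _∸_; s≤s; z≤n)
open import Data.Nat.Properties
open import Data.Integer using (ℤ; -_) renaming (+_ to pos; _+_ to _+ℤ_; _-_ to _-ℤ_)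
import Data.Integer.Properties as ℤ
open import Data.List using (List; []; _∷_; _++_; length; take; drop)
open import Data.List.Properties
  using (length-++; length-take; length-drop; take-take; take-all; drop-drop; take++drop≡id; ++-assoc)
open import Data.Product using (Σ; _×_; _,_; proj₁; proj₂)
open import Data.Unit using (tt)
open import Relation.Nullary using (contradiction)
open import Function.Bundles using (_⇔_; mk⇔)
open import Relation.Binary.PropositionalEquality
open ≡-Reasoning

module _ {A : Set} where

  take-length-++ : ∀ (xs ys : List A) {m} → length xs ≡ m → take m (xs ++ ys) ≡ xs
  take-length-++ []       ys refl = refl
  take-length-++ (x ∷ xs) ys refl = cong (x ∷_) (take-length-++ xs ys refl)

  drop-length-++ : ∀ (xs ys : List A) {m} → length xs ≡ m → drop m (xs ++ ys) ≡ ys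
  drop-length-++ []       ys refl = refl
  drop-length-++ (x ∷ xs) ys refl = drop-length-++ xs ys refl

  take-take-≤ : ∀ {m n} (xs : List A) → m ≤ n → take m (take n xs) ≡ take m xs
  take-take-≤ {m} {n} xs m≤n = trans (take-take m n xs) (cong (λ i → take i xs) (m≤n⇒m⊓n≡m m≤n))

  length-take-≤ : ∀ {m} (xs : List A) → m ≤ length xs → length (take m xs) ≡ m
  length-take-≤ {m} xs m≤∣xs∣ = trans (length-take m xs) (m≤n⇒m⊓n≡m m≤∣xs∣)

  take++take-drop++drop≡id : ∀ m n (xs : List A) →
    take m xs ++ take n (drop m xs) ++ drop (m + n) xs ≡ xs
  take++take-drop++drop≡id m n xs = begin
    take m xs ++ take n (drop m xs) ++ drop (m + n) xs
      ≡⟨ cong (λ ys → take m xs ++ take n (drop m xs) ++ ys) (sym (drop-drop m n xs)) ⟩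
    take m xs ++ take n (drop m xs) ++ drop n (drop m xs)
      ≡⟨ cong (take m xs ++_) (take++drop≡id n (drop m xs)) ⟩
    take m xs ++ drop m xs
      ≡⟨ take++drop≡id m xs ⟩
    xs ∎

module _ {a : ℕ} where

  OccursAt-++⁻ : ∀ (x : Config a) i (u v : Word a) → OccursAt x i (u ++ v) →
                 OccursAt x i u × OccursAt x (i +ℤ pos (length u)) v
  OccursAt-++⁻ x i []      v occ = tt , subst (λ j → OccursAt x j v) (sym (ℤ.+-identityʳ i)) occ
  OccursAt-++⁻ x i (b ∷ u) v (xi≡b , occ) with OccursAt-++⁻ x (i +ℤ pos 1) u v occ
  ... | occ-u , occ-v = (xi≡b , occ-u) , subst (λ j → OccursAt x j v) (ℤ.+-assoc i (pos 1) (pos (length u))) occ-v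

  OccursAt-++⁺ : ∀ (x : Config a) i (u v : Word a) → OccursAt x i u →
                 OccursAt x (i +ℤ pos (length u)) v → OccursAt x i (u ++ v)
  OccursAt-++⁺ x i []      v _              occ-v = subst (λ j → OccursAt x j v) (ℤ.+-identityʳ i) occ-v
  OccursAt-++⁺ x i (b ∷ u) v (xi≡b , occ-u) occ-v =
    xi≡b , OccursAt-++⁺ x (i +ℤ pos 1) u v occ-u
             (subst (λ j → OccursAt x j v) (sym (ℤ.+-assoc i (pos 1) (pos (length u)))) occ-v)

  segment : Config a → ℤ → ℕ → Word a
  segment x i zero    = []
  segment x i (suc j) = x i ∷ segment x (i +ℤ pos 1) j

  OccursAt-segment : ∀ x i j → OccursAt x i (segment x i j)
  OccursAt-segment x i zero    = tt
  OccursAt-segment x i (suc j) = refl , OccursAt-segment x (i +ℤ pos 1) j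

  length-segment : ∀ x i j → length (segment x i j) ≡ j
  length-segment x i zero    = refl
  length-segment x i (suc j) = cong suc (length-segment x (i +ℤ pos 1) j)

module _ {a : ℕ} (X : Config a → Set) where

  Lang-++ˡ : ∀ (u v : Word a) → Lang X (u ++ v) → Lang X u
  Lang-++ˡ u v (x , x∈X , i , occ) = x , x∈X , i , proj₁ (OccursAt-++⁻ x i u v occ)

  Lang-++ʳ : ∀ (u v : Word a) → Lang X (u ++ v) → Lang X v
  Lang-++ʳ u v (x , x∈X , i , occ) = x , x∈X , _ , proj₂ (OccursAt-++⁻ x i u v occ)

  Lang-take : ∀ m (z : Word a) → Lang X z → Lang X (take m z)
  Lang-take m z z∈L = Lang-++ˡ (take m z) (drop m z) (subst (Lang X) (sym (take++drop≡id m z)) z∈L)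

  Lang-drop : ∀ m (z : Word a) → Lang X z → Lang X (drop m z)
  Lang-drop m z z∈L = Lang-++ʳ (take m z) (drop m z) (subst (Lang X) (sym (take++drop≡id m z)) z∈L)

  Lang-extendˡ : ∀ (u : Word a) → Lang X u → ∀ j → Σ (Word a) λ p → length p ≡ j × Lang X (p ++ u)
  Lang-extendˡ u (x , x∈X , i , occ) j =
    segment x (i -ℤ pos j) j , length-segment x _ j ,
    x , x∈X , i -ℤ pos j ,
    OccursAt-++⁺ x _ _ u (OccursAt-segment x _ j) (subst (λ l → OccursAt x l u) (sym i-j+|p|≡i) occ)
    where
    i-j+|p|≡i : (i -ℤ pos j) +ℤ pos (length (segment x (i -ℤ pos j) j)) ≡ i
    i-j+|p|≡i = begin
      (i -ℤ pos j) +ℤ pos (length (segment x (i -ℤ pos j) j))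
        ≡⟨ cong (λ l → (i -ℤ pos j) +ℤ pos l) (length-segment x _ j) ⟩
      (i -ℤ pos j) +ℤ pos j   ≡⟨ ℤ.+-assoc i (- pos j) (pos j) ⟩
      i +ℤ (- pos j +ℤ pos j) ≡⟨ cong (i +ℤ_) (ℤ.+-inverseˡ (pos j)) ⟩
      i +ℤ pos 0              ≡⟨ ℤ.+-identityʳ i ⟩
      i                       ∎

  Lang-extendʳ : ∀ (v : Word a) → Lang X v → ∀ j → Σ (Word a) λ s → length s ≡ j × Lang X (v ++ s)
  Lang-extendʳ v (x , x∈X , i , occ) j =
    segment x (i +ℤ pos (length v)) j , length-segment x _ j ,
    x , x∈X , i , OccursAt-++⁺ x i v _ occ (OccursAt-segment x _ j)

  RauzyGluing : ℕ → Set
  RauzyGluing c = (n : ℕ) → 1 ≤ n → (u v : Word a) → RauzyVertex X n u → RauzyVertex X n v →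
    (k : ℕ) → c + n ∸ 1 ≤ k → RauzyPath X n u v k

  pathAlong : ∀ n k (z : Word a) → Lang X z → length z ≡ n + k →
              RauzyPath X (suc n) (take n z) (drop k z) k
  pathAlong n zero z z∈L |z|≡n+0 =
    subst (λ u → RauzyPath X (suc n) u z 0) (sym (take-all n z (≤-reflexive (trans |z|≡n+0 (+-identityʳ n))))) nil
  pathAlong n (suc k) [] _ |z|≡n+1+k = contradiction (trans |z|≡n+1+k (+-suc n k)) 0≢1+n
  pathAlong n (suc k) (b ∷ z) bz∈L |bz|≡n+1+k =
    cons (b ∷ take n z , Lang-take (suc n) (b ∷ z) bz∈L , length-take-≤ (b ∷ z) 1+n≤|bz| ,
          take-take-≤ (b ∷ z) (n≤1+n n) , refl)
         (pathAlong n k z (Lang-drop 1 (b ∷ z) bz∈L) |z|≡n+k)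
    where
    |z|≡n+k : length z ≡ n + k
    |z|≡n+k = suc-injective (trans |bz|≡n+1+k (+-suc n k))
    1+n≤|bz| : suc n ≤ length (b ∷ z)
    1+n≤|bz| = s≤s (subst (n ≤_) (sym |z|≡n+k) (m≤m+n n k))

  BlockGluing⇒RauzyGluing : ∀ c → BlockGluing X c → RauzyGluing c
  BlockGluing⇒RauzyGluing c glue (suc n) _ u v (u∈L , |u|≡n) (v∈L , |v|≡n) k c+n+1∸1≤k =
    pathThrough (glue u v u∈L v∈L (k ∸ n) (m+n≤o⇒m≤o∸n c c+n≤k))
    where
    c+n≤k : c + n ≤ k
    c+n≤k = subst (_≤ k) (+-∸-assoc c (s≤s z≤n)) c+n+1∸1≤k
    n≤k : n ≤ k
    n≤k = ≤-trans (m≤n+m n c) c+n≤k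
    pathThrough : Σ (Word a) (λ w → length w ≡ k ∸ n × Lang X (u ++ w ++ v)) → RauzyPath X (suc n) u v k
    pathThrough (w , |w|≡k∸n , uwv∈L) =
      subst₂ (λ s t → RauzyPath X (suc n) s t k) (take-length-++ u (w ++ v) |u|≡n) drop-uwv≡v
        (pathAlong n k (u ++ w ++ v) uwv∈L |uwv|≡n+k)
      where
      |uw|≡k : length (u ++ w) ≡ k
      |uw|≡k = trans (length-++ u) (trans (cong₂ _+_ |u|≡n |w|≡k∸n) (m+[n∸m]≡n n≤k))
      |uwv|≡n+k : length (u ++ w ++ v) ≡ n + k
      |uwv|≡n+k = begin
        length (u ++ w ++ v)        ≡⟨ cong length (++-assoc u w v) ⟨
        length ((u ++ w) ++ v)      ≡⟨ length-++ (u ++ w) ⟩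
        length (u ++ w) + length v  ≡⟨ cong₂ _+_ |uw|≡k |v|≡n ⟩
        k + n                       ≡⟨ +-comm k n ⟩
        n + k                       ∎
      drop-uwv≡v : drop k (u ++ w ++ v) ≡ v
      drop-uwv≡v = subst (λ z → drop k z ≡ v) (++-assoc u w v) (drop-length-++ (u ++ w) v |uw|≡k)

  record Spelling (n k : ℕ) (u v : Word a) : Set where
    field
      word        : Word a
      length-word : length word ≡ n + k
      take-word   : take n word ≡ u
      drop-word   : drop k word ≡ v
      vertices    : ∀ j → j ≤ k → Lang X (take n (drop j word))

  spell : ∀ {n u v k} → RauzyPath X (suc n) u v k → length u ≡ n → Lang X v → Spelling n k u v
  spell {n} {u} nil |u|≡n v∈L = record
    { word        = u
    ; length-word = trans |u|≡n (sym (+-identityʳ n))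
    ; take-word   = take-u≡u
    ; drop-word   = refl
    ; vertices    = λ { zero z≤n → subst (Lang X) (sym take-u≡u) v∈L }
    }
    where
    take-u≡u : take n u ≡ u
    take-u≡u = take-all n u (≤-reflexive |u|≡n)
  spell (cons ([] , _ , () , _ , _) _) _ _
  spell {n} {k = suc k} (cons (b ∷ w , bw∈L , |bw|≡1+n , refl , refl) path) _ v∈L = record
    { word        = b ∷ word
    ; length-word = trans (cong suc length-word) (sym (+-suc n k))
    ; take-word   = take-bword≡take-bw
    ; drop-word   = drop-word
    ; vertices    = λ { zero    _       → subst (Lang X) (sym take-bword≡take-bw) (Lang-take n (b ∷ w) bw∈L)
                      ; (suc j) (s≤s j≤k) → vertices j j≤k }
    }
    where
    open Spelling (spell path (suc-injective |bw|≡1+n) v∈L)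
    take-bword≡take-bw : take n (b ∷ word) ≡ take n (b ∷ w)
    take-bword≡take-bw = begin
      take n (b ∷ word)            ≡⟨ take-take-≤ (b ∷ word) (n≤1+n n) ⟨
      take n (b ∷ take n word)     ≡⟨ cong (λ t → take n (b ∷ t)) take-word ⟩
      take n (b ∷ w)               ∎

  spelled-word-decomposition : ∀ {n m u v} (S : Spelling n (n + m) u v) →
    Σ (Word a) λ w → length w ≡ m × Spelling.word S ≡ u ++ w ++ v
  spelled-word-decomposition {n} {m} {u} {v} S = take m (drop n word) , |w|≡m , word≡uwv
    where
    open Spelling S
    |w|≡m : length (take m (drop n word)) ≡ m
    |w|≡m = length-take-≤ (drop n word)
      (subst (m ≤_) (sym (trans (length-drop n word) (trans (cong (_∸ n) length-word) (m+n∸m≡n n (n + m)))))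
        (m≤n+m m n))
    word≡uwv : word ≡ u ++ take m (drop n word) ++ v
    word≡uwv = begin
      word                                                ≡⟨ take++take-drop++drop≡id n m word ⟨
      take n word ++ take m (drop n word) ++ drop (n + m) word
        ≡⟨ cong₂ (λ x y → x ++ take m (drop n word) ++ y) take-word drop-word ⟩
      u ++ take m (drop n word) ++ v                      ∎

  spelled-factor : ∀ {n k u v} (S : Spelling n k u v) (q y r : Word a) → Spelling.word S ≡ q ++ y ++ r →
                   length q ≤ k → length y ≡ n → Lang X y
  spelled-factor {n} S q y r word≡qyr |q|≤k |y|≡n = subst (Lang X) y-is-vertex (vertices (length q) |q|≤k)
    where
    open Spelling S
    y-is-vertex : take n (drop (length q) word) ≡ y
    y-is-vertex = begin
      take n (drop (length q) word)          ≡⟨ cong (λ z → take n (drop (length q) z)) word≡qyr ⟩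
      take n (drop (length q) (q ++ y ++ r)) ≡⟨ cong (take n) (drop-length-++ q (y ++ r) refl) ⟩
      take n (y ++ r)                        ≡⟨ take-length-++ y r |y|≡n ⟩
      y                                      ∎

  RauzyGluing⇒BlockGluing : ∀ c → RauzyGluing c → BlockGluing X c
  RauzyGluing⇒BlockGluing c paths u v u∈L v∈L m c≤m =
    glueInside (Lang-extendˡ u u∈L (m + length v)) (Lang-extendʳ v v∈L (length u + m))
    where
    N : ℕ
    N = length u + (m + length v)
    c+N≤N+m : c + suc N ∸ 1 ≤ N + m
    c+N≤N+m = subst (_≤ N + m) (trans (+-comm N c) (sym (+-∸-assoc c (s≤s z≤n)))) (+-monoʳ-≤ N c≤m)
    glueInside : Σ (Word a) (λ p → length p ≡ m + length v × Lang X (p ++ u)) →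
                 Σ (Word a) (λ s → length s ≡ length u + m × Lang X (v ++ s)) →
                 Σ (Word a) (λ w → length w ≡ m × Lang X (u ++ w ++ v))
    glueInside (p , |p|≡m+|v| , pu∈L) (s , |s|≡|u|+m , vs∈L) = w , |w|≡m , uwv∈L
      where
      |pu|≡N : length (p ++ u) ≡ N
      |pu|≡N = trans (length-++ p) (trans (cong (_+ length u) |p|≡m+|v|) (+-comm (m + length v) (length u)))
      |vs|≡N : length (v ++ s) ≡ N
      |vs|≡N = trans (length-++ v) (trans (cong (length v +_) |s|≡|u|+m)
                 (trans (+-comm (length v) (length u + m)) (+-assoc (length u) m (length v))))
      spelling : Spelling N (N + m) (p ++ u) (v ++ s)
      spelling = spell (paths (suc N) (s≤s z≤n) (p ++ u) (v ++ s) (pu∈L , |pu|≡N) (vs∈L , |vs|≡N) (N + m) c+N≤N+m)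
                       |pu|≡N vs∈L
      open Spelling spelling using (word)
      decomposition : Σ (Word a) λ w → length w ≡ m × word ≡ (p ++ u) ++ w ++ v ++ s
      decomposition = spelled-word-decomposition spelling
      w : Word a
      w = proj₁ decomposition
      |w|≡m : length w ≡ m
      |w|≡m = proj₁ (proj₂ decomposition)
      |uwv|≡N : length (u ++ w ++ v) ≡ N
      |uwv|≡N = trans (length-++ u) (cong (length u +_) (trans (length-++ w) (cong (_+ length v) |w|≡m)))
      word≡puwvs : word ≡ p ++ (u ++ w ++ v) ++ s
      word≡puwvs = begin
        word                                               ≡⟨ proj₂ (proj₂ decomposition) ⟩
        (p ++ u) ++ w ++ v ++ s                            ≡⟨ ++-assoc p u (w ++ v ++ s) ⟩
        p ++ u ++ w ++ v ++ s                              ≡⟨ cong (λ t → p ++ u ++ t) (++-assoc w v s) ⟨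
        p ++ u ++ (w ++ v) ++ s                            ≡⟨ cong (p ++_) (++-assoc u (w ++ v) s) ⟨
        p ++ (u ++ w ++ v) ++ s                            ∎
      |p|≤N+m : length p ≤ N + m
      |p|≤N+m = ≤-trans (≤-reflexive |p|≡m+|v|) (≤-trans (m≤n+m (m + length v) (length u)) (m≤m+n N m))
      uwv∈L : Lang X (u ++ w ++ v)
      uwv∈L = spelled-factor spelling p (u ++ w ++ v) s word≡puwvs |p|≤N+m |uwv|≡N

mainTheorem7 : (a c : ℕ) (X : Config a → Set) → IsSubshift X →
    (BlockGluing X c ⇔
      ((n : ℕ) → 1 ≤ n → (u v : Word a) → RauzyVertex X n u → RauzyVertex X n v →
        (k : ℕ) → c + n ∸ 1 ≤ k → RauzyPath X n u v k))
mainTheorem7 a c X _ = mk⇔ (BlockGluing⇒RauzyGluing X c) (RauzyGluing⇒BlockGluing X c)
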